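{- Let $X,Y,Z$ be finite multisets of non-negative integers. Then $X\succ Y$ if and only if $X\cup Z\succ Y\cup Z$.
   Context: For a finite multiset $X$ of non-negative numbers and a non-negative integer $k$, $s_k(X)$ denotes the sum of the $\min(k,|X|)$ largest elements of $X$ (counted with multiplicity), and $s(X)=s_{|X|}(X)$ is the sum of all elements of $X$. We say $X$ majorizes $Y$, written $X\succ Y$, if $s(X)=s(Y)$ and $s_k(X)\geqslant s_k(Y)$ for all $k$. Here $X\cup Z$ denotes the multiset union (multiplicities add). -}

module Defs where

open import Data.Nat using (ℕ; _≤_)
open import Data.Product using (_×_)
open import Relation.Binary.PropositionalEquality using (_≡_)
open import Data.Nat.Properties using (≤-decTotalOrder)
open import Data.List using (List; reverse; take; _++_)
open import Data.Nat.ListAction using (sum)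
import Data.List.Sort as S

-- A finite multiset of non-negative integers is represented by a list
-- (order irrelevant; all notions below are invariant under permutation).
-- Multiset union X ∪ Z is list concatenation X ++ Z.

sortDesc : List ℕ → List ℕ
sortDesc xs = reverse (S.sort ≤-decTotalOrder xs)

sₖ : ℕ → List ℕ → ℕ
sₖ k xs = sum (take k (sortDesc xs))

s : List ℕ → ℕ
s xs = sum xs

_≻_ : List ℕ → List ℕ → Set
X ≻ Y = (s X ≡ s Y) × (∀ k → sₖ k Y ≤ sₖ k X)

module Submission where

-- For a threshold t write  excess t X = Σ_{x ∈ X} (x ∸ t).
-- Weak majorization by prefix sums is equivalent to domination of all
-- excesses:
--     (∀ k → s_k Y ≤ s_k X)   ⇔   (∀ t → excess t Y ≤ excess t X).
-- One half rests on the bound  s_k X ≤ excess t X + k·t,  valid for every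
-- k and t; the other on the fact that for a non-increasing list this bound
-- is attained, for each t by a suitable k (the number of entries above t)
-- and for each k by a suitable t (the (k+1)-st entry, or 0).
-- Unlike prefix sums, excesses are additive under multiset union, so
-- excess-domination of X over Y is the same as that of X ∪ Z over Y ∪ Z,
-- by cancelling the summand excess t Z.  Total sums behave likewise, which
-- gives the proposition.

open import Defs
open import Data.Nat using (ℕ; zero; suc; _+_; _*_; _∸_; _≤_; z≤n; _≤?_)
open import Data.List using (List; []; _∷_; _++_; map; take; reverse)
open import Function.Bundles using (_⇔_; mk⇔; Equivalence)
open import Function using (flip)
open import Data.Product using (_,_; ∃)
open import Relation.Nullary using (yes; no)
open import Relation.Binary.PropositionalEquality
open import Data.Nat.Properties
open import Data.Nat.ListAction using (sum)
open import Data.Nat.ListAction.Properties using (sum-++; sum-↭)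
open import Data.List.Properties using (map-++; unfold-reverse)
open import Data.List.Relation.Unary.All as All using (All; []; _∷_)
import Data.List.Relation.Unary.All.Properties as AllP
open import Data.List.Relation.Unary.AllPairs using (AllPairs; []; _∷_)
import Data.List.Relation.Unary.AllPairs.Properties as AllPairsP
open import Data.List.Relation.Unary.Linked.Properties using (Linked⇒AllPairs)
open import Data.List.Relation.Binary.Permutation.Propositional using (_↭_; ↭-trans)
open import Data.List.Relation.Binary.Permutation.Propositional.Properties using (↭-reverse; map⁺)
import Data.List.Sort as Sort
open import Data.Nat.Solver using (module +-*-Solver)
open +-*-Solver using (solve; _:+_; _:=_)

NonIncreasing : List ℕ → Set
NonIncreasing = AllPairs (flip _≤_)

All-reverse : ∀ {P : ℕ → Set} {xs} → All P xs → All P (reverse xs)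
All-reverse [] = []
All-reverse {xs = x ∷ xs} (p ∷ ps) rewrite unfold-reverse x xs =
  AllP.++⁺ (All-reverse ps) (p ∷ [])

reverse-nonIncreasing : ∀ {xs} → AllPairs _≤_ xs → NonIncreasing (reverse xs)
reverse-nonIncreasing [] = []
reverse-nonIncreasing {x ∷ xs} (x≤xs ∷ rest) rewrite unfold-reverse x xs =
  AllPairsP.++⁺ (reverse-nonIncreasing rest) ([] ∷ [])
    (All-reverse (All.map (λ x≤y → x≤y ∷ []) x≤xs))

sortDesc-nonIncreasing : ∀ X → NonIncreasing (sortDesc X)
sortDesc-nonIncreasing X =
  reverse-nonIncreasing (Linked⇒AllPairs ≤-trans (Sort.sort-↗ ≤-decTotalOrder X))

sortDesc-↭ : ∀ X → sortDesc X ↭ X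
sortDesc-↭ X = ↭-trans (↭-reverse _) (Sort.sort-↭ ≤-decTotalOrder X)

excess : ℕ → List ℕ → ℕ
excess t xs = sum (map (_∸ t) xs)

excess-sortDesc : ∀ t X → excess t (sortDesc X) ≡ excess t X
excess-sortDesc t X = sum-↭ (map⁺ (_∸ t) (sortDesc-↭ X))

excess-++ : ∀ t X Z → excess t (X ++ Z) ≡ excess t X + excess t Z
excess-++ t X Z rewrite map-++ (_∸ t) X Z = sum-++ (map (_∸ t) X) (map (_∸ t) Z)

excess-bounded : ∀ {t xs} → All (_≤ t) xs → excess t xs ≡ 0
excess-bounded [] = refl
excess-bounded (x≤t ∷ xs≤t) rewrite m≤n⇒m∸n≡0 x≤t | excess-bounded xs≤t = refl

-- Splitting off one entry x ≥ t: its contribution (x ∸ t) + t is x itself.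
-- This is the inductive step of both attainment lemmas below.
split-entry : ∀ x t e k → t ≤ x → (x ∸ t + e) + (suc k) * t ≡ x + (e + k * t)
split-entry x t e k t≤x = begin
  (x ∸ t + e) + (t + k * t)   ≡⟨ shuffle (x ∸ t) e t (k * t) ⟩
  (x ∸ t + t) + (e + k * t)   ≡⟨ cong (_+ (e + k * t)) (m∸n+n≡m t≤x) ⟩
  x + (e + k * t)             ∎
  where
  open ≡-Reasoning
  shuffle : ∀ a e t r → (a + e) + (t + r) ≡ (a + t) + (e + r)
  shuffle = solve 4 (λ a e t r → (a :+ e) :+ (t :+ r) := (a :+ t) :+ (e :+ r)) refl

-- The key bound: any k entries sum to at most k·t plus the excess over t,
-- since each entry x satisfies x ≤ (x ∸ t) + t.
prefix-bound : ∀ k xs t → sum (take k xs) ≤ excess t xs + k * t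
prefix-bound zero xs t = z≤n
prefix-bound (suc k) [] t = z≤n
prefix-bound (suc k) (x ∷ xs) t =
  ≤-trans (+-mono-≤ (m≤n+m∸n x t) (prefix-bound k xs t))
          (≤-reflexive (shuffle (x ∸ t) (excess t xs) t (k * t)))
  where
  shuffle : ∀ a e t r → (t + a) + (e + r) ≡ (a + e) + (t + r)
  shuffle = solve 4 (λ a e t r → (t :+ a) :+ (e :+ r) := (a :+ e) :+ (t :+ r)) refl

-- For a non-increasing list and any threshold t, the bound is attained
-- with k the number of entries exceeding t.
bound-attained-at-threshold : ∀ {xs} → NonIncreasing xs → ∀ t →
  ∃ λ k → excess t xs + k * t ≤ sum (take k xs)
bound-attained-at-threshold [] t = 0 , z≤n
bound-attained-at-threshold {x ∷ xs} (x≥xs ∷ rest) t with x ≤? t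
... | yes x≤t = 0 , ≤-reflexive (begin
  excess t (x ∷ xs) + 0     ≡⟨ +-identityʳ _ ⟩
  excess t (x ∷ xs)         ≡⟨ excess-bounded (x≤t ∷ All.map (λ y≤x → ≤-trans y≤x x≤t) x≥xs) ⟩
  0                         ∎)
  where open ≡-Reasoning
... | no x≰t with bound-attained-at-threshold rest t
...   | k , attained = suc k ,
  subst (_≤ x + sum (take k xs))
        (sym (split-entry x t (excess t xs) k (≰⇒≥ x≰t)))
        (+-monoʳ-≤ x attained)

entryOrZero : ℕ → List ℕ → ℕ
entryOrZero k [] = 0
entryOrZero zero (x ∷ xs) = x
entryOrZero (suc k) (x ∷ xs) = entryOrZero k xs

entryOrZero-bounded : ∀ {b} k {xs} → All (_≤ b) xs → entryOrZero k xs ≤ b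
entryOrZero-bounded k [] = z≤n
entryOrZero-bounded zero (x≤b ∷ _) = x≤b
entryOrZero-bounded (suc k) (_ ∷ xs≤b) = entryOrZero-bounded k xs≤b

-- For a non-increasing list and any k, the bound is attained with t the
-- (k+1)-st largest entry: the first k entries are ≥ t, the rest are ≤ t.
bound-attained-at-index : ∀ {xs} → NonIncreasing xs → ∀ k →
  excess (entryOrZero k xs) xs + k * entryOrZero k xs ≤ sum (take k xs)
bound-attained-at-index [] zero = z≤n
bound-attained-at-index [] (suc k) = ≤-reflexive (*-zeroʳ (suc k))
bound-attained-at-index {x ∷ xs} (x≥xs ∷ _) zero = ≤-reflexive (begin
  excess x (x ∷ xs) + 0     ≡⟨ +-identityʳ _ ⟩
  excess x (x ∷ xs)         ≡⟨ excess-bounded (≤-refl ∷ x≥xs) ⟩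
  0                         ∎)
  where open ≡-Reasoning
bound-attained-at-index {x ∷ xs} (x≥xs ∷ rest) (suc k) =
  subst (_≤ x + sum (take k xs))
        (sym (split-entry x t (excess t xs) k (entryOrZero-bounded k x≥xs)))
        (+-monoʳ-≤ x (bound-attained-at-index rest k))
  where t = entryOrZero k xs

prefix⇒excess : ∀ X Y → (∀ k → sₖ k Y ≤ sₖ k X) → ∀ t → excess t Y ≤ excess t X
prefix⇒excess X Y prefix t with bound-attained-at-threshold (sortDesc-nonIncreasing Y) t
... | k , attained = +-cancelʳ-≤ (k * t) (excess t Y) (excess t X) (begin
  excess t Y + k * t                  ≡⟨ cong (_+ k * t) (excess-sortDesc t Y) ⟨
  excess t (sortDesc Y) + k * t       ≤⟨ attained ⟩
  sₖ k Y                              ≤⟨ prefix k ⟩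
  sₖ k X                              ≤⟨ prefix-bound k (sortDesc X) t ⟩
  excess t (sortDesc X) + k * t       ≡⟨ cong (_+ k * t) (excess-sortDesc t X) ⟩
  excess t X + k * t                  ∎)
  where open ≤-Reasoning

excess⇒prefix : ∀ X Y → (∀ t → excess t Y ≤ excess t X) → ∀ k → sₖ k Y ≤ sₖ k X
excess⇒prefix X Y dom k = begin
  sₖ k Y                              ≤⟨ prefix-bound k (sortDesc Y) t ⟩
  excess t (sortDesc Y) + k * t       ≡⟨ cong (_+ k * t) (excess-sortDesc t Y) ⟩
  excess t Y + k * t                  ≤⟨ +-monoˡ-≤ (k * t) (dom t) ⟩
  excess t X + k * t                  ≡⟨ cong (_+ k * t) (excess-sortDesc t X) ⟨
  excess t (sortDesc X) + k * t       ≤⟨ bound-attained-at-index (sortDesc-nonIncreasing X) k ⟩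
  sₖ k X                              ∎
  where
  open ≤-Reasoning
  t = entryOrZero k (sortDesc X)

excess-dom-++ : ∀ X Y Z → (∀ t → excess t Y ≤ excess t X) ⇔
                          (∀ t → excess t (Y ++ Z) ≤ excess t (X ++ Z))
excess-dom-++ X Y Z = mk⇔
  (λ dom t → subst₂ _≤_ (sym (excess-++ t Y Z)) (sym (excess-++ t X Z))
                        (+-monoˡ-≤ (excess t Z) (dom t)))
  (λ dom t → +-cancelʳ-≤ (excess t Z) (excess t Y) (excess t X)
                (subst₂ _≤_ (excess-++ t Y Z) (excess-++ t X Z) (dom t)))

sum-eq-++ : ∀ X Y Z → (s X ≡ s Y) ⇔ (s (X ++ Z) ≡ s (Y ++ Z))
sum-eq-++ X Y Z = mk⇔
  (λ eq → trans (sum-++ X Z) (trans (cong (_+ s Z) eq) (sym (sum-++ Y Z))))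
  (λ eq → +-cancelʳ-≡ (s Z) (s X) (s Y) (trans (sym (sum-++ X Z)) (trans eq (sum-++ Y Z))))

proposition1 : (X Y Z : List ℕ) → X ≻ Y ⇔ (X ++ Z) ≻ (Y ++ Z)
proposition1 X Y Z = mk⇔
  (λ (eq , prefix) →
     Equivalence.to (sum-eq-++ X Y Z) eq ,
     excess⇒prefix (X ++ Z) (Y ++ Z)
       (Equivalence.to (excess-dom-++ X Y Z) (prefix⇒excess X Y prefix)))
  (λ (eq , prefix) →
     Equivalence.from (sum-eq-++ X Y Z) eq ,
     excess⇒prefix X Y
       (Equivalence.from (excess-dom-++ X Y Z) (prefix⇒excess (X ++ Z) (Y ++ Z) prefix)))
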